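{- For all integers $n\ge 1$ and $k\ge 3$, the firecracker $F_{n,k}$ is neighborhood-prime.
   Context: A neighborhood-prime labeling of a simple graph $G$ with $N$ vertices is a bijection $f:V(G)\to\{1,\ldots,N\}$ such that for every vertex $v$ with $\deg(v)>1$, $\gcd\{f(u):u\in N(v)\}=1$, where $N(v)$ is the neighborhood of $v$; a graph admitting one is neighborhood-prime. A $k$-star is the star on $k$ vertices (a center adjacent to $k-1$ leaves). The $(n,k)$-firecracker $F_{n,k}$ consists of a path $u_1,\ldots,u_n$ together with $n$ disjoint $k$-stars, where $u_i$ is one of the leaves of the $i$-th star (i.e., $u_i$ is adjacent to a center $v_i$, which is additionally adjacent to $k-2$ further leaves). -}

module Defs where

open import Data.Nat using (ℕ; zero; suc; _*_; _<_)
open import Data.Nat.GCD using (gcd)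
open import Data.Bool using (Bool; true; false; _∧_; _∨_; not)
open import Data.Fin using (Fin; toℕ; remQuot)
open import Data.List using (List; filter; map; foldr; length; allFin)
open import Data.Product using (_×_; _,_; Σ)
open import Function.Bundles using (Bijection; _⤖_)
open import Relation.Nullary.Decidable using (⌊_⌋)
open import Relation.Binary.PropositionalEquality using (_≡_; refl)
import Data.Bool.Properties
import Data.Nat as ℕ
import Data.Fin as F

record SimpleGraph (N : ℕ) : Set where
  field
    adj       : Fin N → Fin N → Bool
    adj-sym   : ∀ u v → adj u v ≡ adj v u
    adj-irrefl : ∀ v → adj v v ≡ false

open SimpleGraph public

nbhd : ∀ {N} → SimpleGraph N → Fin N → List (Fin N)
nbhd G v = filter (λ u → adj G v u Data.Bool.≟ true) (allFin _)

degree : ∀ {N} → SimpleGraph N → Fin N → ℕ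
degree G v = length (nbhd G v)

gcdList : List ℕ → ℕ
gcdList = foldr gcd 0

-- A neighborhood-prime labeling: a bijection f : V(G) → {1,…,N}
-- (encoded as a bijection Fin N → Fin N, with label(v) = 1 + toℕ (f v))
-- such that every vertex of degree > 1 has neighbourhood labels with gcd 1.
IsNeighborhoodPrimeLabeling : ∀ {N} → SimpleGraph N → (Fin N → Fin N) → Set
IsNeighborhoodPrimeLabeling G f =
  ∀ v → 1 < degree G v → gcdList (map (λ u → suc (toℕ (f u))) (nbhd G v)) ≡ 1

NeighborhoodPrime : ∀ {N} → SimpleGraph N → Set
NeighborhoodPrime {N} G =
  Σ (Fin N ⤖ Fin N) λ b → IsNeighborhoodPrimeLabeling G (Bijection.to b)

-- Vertex x ∈ Fin (n * k)
-- is decoded as (i , a) = remQuot k x with i ∈ Fin n (the star index) and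
-- a ∈ Fin k (position in the i-th star):
--   a = 0 : u_i (path vertex, a leaf of the i-th star)
--   a = 1 : v_i (centre of the i-th star)
--   a ≥ 2 : the remaining k-2 leaves of the i-th star.
-- Edges: u_i ~ u_{i+1} (path), and v_i ~ (i , a) for every a ≠ 1 (star).
isZ : ∀ {k} → Fin k → Bool
isZ x = ℕ._≡ᵇ_ (toℕ x) 0

is1 : ∀ {k} → Fin k → Bool
is1 x = ℕ._≡ᵇ_ (toℕ x) 1

fcAdjPair : ∀ {n k} → Fin n × Fin k → Fin n × Fin k → Bool
fcAdjPair (i , a) (j , b) =
  (isZ a ∧ isZ b ∧ (ℕ._≡ᵇ_ (suc (toℕ i)) (toℕ j) ∨ ℕ._≡ᵇ_ (suc (toℕ j)) (toℕ i)))
  ∨ (ℕ._≡ᵇ_ (toℕ i) (toℕ j) ∧ ((is1 a ∧ not (is1 b)) ∨ (is1 b ∧ not (is1 a))))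

private
  ≡ᵇ-sym : ∀ m n → ℕ._≡ᵇ_ m n ≡ ℕ._≡ᵇ_ n m
  ≡ᵇ-sym zero zero = refl
  ≡ᵇ-sym zero (suc n) = refl
  ≡ᵇ-sym (suc m) zero = refl
  ≡ᵇ-sym (suc m) (suc n) = ≡ᵇ-sym m n

  ≡ᵇ-refl : ∀ m → ℕ._≡ᵇ_ m m ≡ true
  ≡ᵇ-refl zero = refl
  ≡ᵇ-refl (suc m) = ≡ᵇ-refl m

  ≡ᵇ-suc : ∀ m → ℕ._≡ᵇ_ (suc m) m ≡ false
  ≡ᵇ-suc zero = refl
  ≡ᵇ-suc (suc m) = ≡ᵇ-suc m

  bool4 : ∀ p q r s → (p ∧ q ∧ r) ∨ s ≡ (q ∧ p ∧ r) ∨ s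
  bool4 false false r s = refl
  bool4 false true r s = refl
  bool4 true false r s = refl
  bool4 true true r s = refl

fcAdjPair-sym : ∀ {n k} (x y : Fin n × Fin k) → fcAdjPair x y ≡ fcAdjPair y x
fcAdjPair-sym (i , a) (j , b)
  rewrite ≡ᵇ-sym (toℕ i) (toℕ j)
        | Data.Bool.Properties.∨-comm (ℕ._≡ᵇ_ (suc (toℕ i)) (toℕ j)) (ℕ._≡ᵇ_ (suc (toℕ j)) (toℕ i))
        | Data.Bool.Properties.∨-comm (ℕ._≡ᵇ_ (toℕ a) 1 ∧ not (ℕ._≡ᵇ_ (toℕ b) 1)) (ℕ._≡ᵇ_ (toℕ b) 1 ∧ not (ℕ._≡ᵇ_ (toℕ a) 1))
  = bool4 (ℕ._≡ᵇ_ (toℕ a) 0) (ℕ._≡ᵇ_ (toℕ b) 0) _ _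

fcAdjPair-irrefl : ∀ {n k} (x : Fin n × Fin k) → fcAdjPair x x ≡ false
fcAdjPair-irrefl (i , a) rewrite ≡ᵇ-suc (toℕ i) | ≡ᵇ-refl (toℕ i)
  with ℕ._≡ᵇ_ (toℕ a) 0 | ℕ._≡ᵇ_ (toℕ a) 1
... | false | false = refl
... | false | true = refl
... | true | false = refl
... | true | true = refl

firecracker : (n k : ℕ) → SimpleGraph (n * k)
firecracker n k = record
  { adj = λ x y → fcAdjPair (remQuot {n} k x) (remQuot {n} k y)
  ; adj-sym = λ x y → fcAdjPair-sym (remQuot {n} k x) (remQuot {n} k y)
  ; adj-irrefl = λ x → fcAdjPair-irrefl (remQuot {n} k x)
  }

module Submission where

-- Label the vertices of the i-th star (0-based) by k·i + 1, …, k·i + k, giving the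
-- centre v_i the label k·i + 1, the extra leaves the labels k·i + 2, …, k·i + k − 1 in
-- order, and the path vertex u_i the label k·(i + 1).  Then the centre sees the two
-- consecutive labels k·(i + 1) − 1 (last extra leaf) and k·(i + 1) (u_i); the path vertex
-- u_i sees k·i + 1 (v_i) and either k·i (u_{i−1}) or, for i = 0, the label 1; and every
-- extra leaf has degree 1.

open import Defs
open import Data.Nat as ℕ using (ℕ; suc; _≤_; _+_; _*_; _<_; z≤n; s≤s; _≡ᵇ_)
open import Data.Nat.Properties using (≤-trans; ≡ᵇ⇒≡; ≡⇒≡ᵇ; +-suc; +-comm; *-suc; *-zeroʳ; +-identityʳ)
open import Data.Nat.Divisibility using (_∣_; ∣-trans; ∣1⇒≡1; ∣m+n∣m⇒∣n)
open import Data.Nat.GCD using (gcd[m,n]∣m; gcd[m,n]∣n)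
open import Data.Bool using (true; false)
import Data.Bool
open import Data.Bool.Properties using (T-≡; ∨-zeroʳ)
open import Data.Empty using (⊥-elim)
open import Data.Fin using (Fin; toℕ; remQuot; combine; fromℕ; inject₁; lower₁)
open import Data.Fin.Patterns using (0F; 1F)
open import Data.Fin.Properties using (*↔×; remQuot-combine; combine-remQuot; toℕ-combine; toℕ-injective; toℕ-fromℕ; toℕ-inject₁; inject₁-lower₁; lower₁-inject₁′; toℕ-inject₁-≢)
open import Data.List using (List; _∷_; map; length; allFin)
open import Data.List.Membership.Propositional using (_∈_)
open import Data.List.Membership.Propositional.Properties using (∈-filter⁺; ∈-filter⁻; ∈-allFin; ∈-map⁺)
open import Data.List.Relation.Unary.Any using (here; there)
open import Data.List.Relation.Unary.All as All using (All; []; _∷_)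
open import Data.List.Relation.Unary.AllPairs using ([]; _∷_)
open import Data.List.Relation.Unary.Unique.Propositional using (Unique)
open import Data.List.Relation.Unary.Unique.Propositional.Properties using (allFin⁺; filter⁺)
open import Data.Product using (_,_; proj₂; ∃; uncurry)
open import Data.Product.Function.NonDependent.Propositional using (_×-↔_)
open import Data.Sum using (_⊎_; inj₁; inj₂)
open import Function.Bundles using (_↔_; Inverse; Equivalence; mk↔ₛ′)
open import Function.Construct.Composition using (_↔-∘_)
open import Function.Construct.Identity using (↔-id)
open import Function.Construct.Symmetry using (↔-sym)
open import Function.Properties.Inverse using (↔⇒⤖)
open import Relation.Nullary using (yes; no)
open import Relation.Binary.PropositionalEquality using (_≡_; refl; sym; trans; cong; cong₂; subst; module ≡-Reasoning)

gcdList-∣ : ∀ {xs : List ℕ} {x} → x ∈ xs → gcdList xs ∣ x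
gcdList-∣ {y ∷ ys} (here refl) = gcd[m,n]∣m y (gcdList ys)
gcdList-∣ {y ∷ ys} (there x∈ys) = ∣-trans (gcd[m,n]∣n y (gcdList ys)) (gcdList-∣ x∈ys)

gcdList≡1-consecutive : ∀ {xs : List ℕ} {x} → x ∈ xs → suc x ∈ xs → gcdList xs ≡ 1
gcdList≡1-consecutive {xs} {x} x∈xs 1+x∈xs =
  ∣1⇒≡1 (∣m+n∣m⇒∣n (subst (gcdList xs ∣_) (+-comm 1 x) (gcdList-∣ 1+x∈xs)) (gcdList-∣ x∈xs))

gcdList≡1-one : ∀ {xs : List ℕ} → 1 ∈ xs → gcdList xs ≡ 1
gcdList≡1-one 1∈xs = ∣1⇒≡1 (gcdList-∣ 1∈xs)

length≤1-unique-constant : ∀ {A : Set} {xs : List A} (y : A) → Unique xs → All (_≡ y) xs → length xs ≤ 1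
length≤1-unique-constant y [] [] = z≤n
length≤1-unique-constant y (_ ∷ []) (_ ∷ []) = s≤s z≤n
length≤1-unique-constant y ((x₁≢x₂ ∷ _) ∷ _) (x₁≡y ∷ x₂≡y ∷ _) = ⊥-elim (x₁≢x₂ (trans x₁≡y (sym x₂≡y)))

module _ {N} (G : SimpleGraph N) where

  ∈-nbhd : ∀ {v u} → adj G v u ≡ true → u ∈ nbhd G v
  ∈-nbhd {v} {u} = ∈-filter⁺ (λ w → adj G v w Data.Bool.≟ true) (∈-allFin u)

  degree≤1 : ∀ {v} w → (∀ u → adj G v u ≡ true → u ≡ w) → degree G v ≤ 1
  degree≤1 {v} w onlyW =
    length≤1-unique-constant w (filter⁺ adj? (allFin⁺ N))
      (All.tabulate (λ u∈ → onlyW _ (proj₂ (∈-filter⁻ adj? {xs = allFin N} u∈))))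
    where adj? = λ u → adj G v u Data.Bool.≟ true

  module _ (label : Fin N → ℕ) where

    nbhdGcd≡1-consecutive : ∀ {v x y} → adj G v x ≡ true → adj G v y ≡ true →
                            label y ≡ suc (label x) → gcdList (map label (nbhd G v)) ≡ 1
    nbhdGcd≡1-consecutive v~x v~y y≡1+x =
      gcdList≡1-consecutive (∈-map⁺ label (∈-nbhd v~x))
        (subst (_∈ map label (nbhd G _)) y≡1+x (∈-map⁺ label (∈-nbhd v~y)))

    nbhdGcd≡1-one : ∀ {v x} → adj G v x ≡ true → label x ≡ 1 → gcdList (map label (nbhd G v)) ≡ 1
    nbhdGcd≡1-one v~x x≡1 =
      gcdList≡1-one (subst (_∈ map label (nbhd G _)) x≡1 (∈-map⁺ label (∈-nbhd v~x)))

rotate : ∀ {p} → Fin (suc p) → Fin (suc p)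
rotate {p} 0F = fromℕ p
rotate (Fin.suc j) = inject₁ j

unrotate : ∀ {p} → Fin (suc p) → Fin (suc p)
unrotate {p} b with p ℕ.≟ toℕ b
... | yes _ = 0F
... | no p≢b = Fin.suc (lower₁ b p≢b)

rotate-unrotate : ∀ {p} (b : Fin (suc p)) → rotate (unrotate b) ≡ b
rotate-unrotate {p} b with p ℕ.≟ toℕ b
... | yes p≡b = toℕ-injective (trans (toℕ-fromℕ p) p≡b)
... | no p≢b = inject₁-lower₁ b p≢b

unrotate-rotate : ∀ {p} (a : Fin (suc p)) → unrotate (rotate a) ≡ a
unrotate-rotate {p} 0F with p ℕ.≟ toℕ (fromℕ p)
... | yes _ = refl
... | no p≢p = ⊥-elim (p≢p (sym (toℕ-fromℕ p)))
unrotate-rotate {p} (Fin.suc j) with p ℕ.≟ toℕ (inject₁ j)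
... | yes p≡j = ⊥-elim (toℕ-inject₁-≢ j p≡j)
... | no p≢j = cong Fin.suc (lower₁-inject₁′ j p≢j)

rotate↔ : ∀ {p} → Fin (suc p) ↔ Fin (suc p)
rotate↔ = mk↔ₛ′ rotate unrotate rotate-unrotate unrotate-rotate

blockwise : ∀ {n K} → Fin K ↔ Fin K → Fin (n * K) ↔ Fin (n * K)
blockwise {n} π = ↔-sym (*↔× {n}) ↔-∘ ((↔-id (Fin n) ×-↔ π) ↔-∘ *↔× {n})

blockwise-combine : ∀ {n K} (π : Fin K ↔ Fin K) (i : Fin n) (b : Fin K) →
                    Inverse.to (blockwise {n} π) (combine i b) ≡ combine i (Inverse.to π b)
blockwise-combine {n} {K} π i b =
  cong (λ (i′ , b′) → combine {n} i′ (Inverse.to π b′)) (remQuot-combine {n} {K} i b)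

≡ᵇ-refl : ∀ m → (m ≡ᵇ m) ≡ true
≡ᵇ-refl m = Equivalence.to T-≡ (≡⇒≡ᵇ m m refl)

toℕ≡0⊎pred : ∀ {n} (i : Fin n) → toℕ i ≡ 0 ⊎ ∃ λ (j : Fin n) → suc (toℕ j) ≡ toℕ i
toℕ≡0⊎pred 0F = inj₁ refl
toℕ≡0⊎pred (Fin.suc j) = inj₂ (inject₁ j , cong suc (toℕ-inject₁ j))

module Firecracker (n m : ℕ) where

  K : ℕ
  K = 3 + m

  G : SimpleGraph (n * K)
  G = firecracker n K

  path centre : Fin n → Fin (n * K)
  path i = combine i 0F
  centre i = combine i 1F

  lastLeaf : Fin n → Fin (n * K)
  lastLeaf i = combine i (fromℕ (2 + m))

  adj-combine⁺ : ∀ (i j : Fin n) (a b : Fin K) →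
                 fcAdjPair (i , a) (j , b) ≡ true → adj G (combine i a) (combine j b) ≡ true
  adj-combine⁺ i j a b =
    subst (_≡ true) (sym (cong₂ fcAdjPair (remQuot-combine {n} {K} i a) (remQuot-combine {n} {K} j b)))

  centre~path : ∀ (i : Fin n) → adj G (centre i) (path i) ≡ true
  centre~path i = adj-combine⁺ i i 1F 0F pair
    where
    pair : fcAdjPair {n} {K} (i , 1F) (i , 0F) ≡ true
    pair rewrite ≡ᵇ-refl (toℕ i) = refl

  centre~lastLeaf : ∀ (i : Fin n) → adj G (centre i) (lastLeaf i) ≡ true
  centre~lastLeaf i = adj-combine⁺ i i 1F _ pair
    where
    pair : fcAdjPair {n} {K} (i , 1F) (i , fromℕ (2 + m)) ≡ true
    pair rewrite ≡ᵇ-refl (toℕ i) = refl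

  path~centre : ∀ (i : Fin n) → adj G (path i) (centre i) ≡ true
  path~centre i = adj-combine⁺ i i 0F 1F pair
    where
    pair : fcAdjPair {n} {K} (i , 0F) (i , 1F) ≡ true
    pair rewrite ≡ᵇ-refl (toℕ i) = refl

  path~path : ∀ (i j : Fin n) → suc (toℕ j) ≡ toℕ i → adj G (path i) (path j) ≡ true
  path~path i j 1+j≡i = adj-combine⁺ i j 0F 0F pair
    where
    pair : fcAdjPair {n} {K} (i , 0F) (j , 0F) ≡ true
    pair rewrite sym 1+j≡i | ≡ᵇ-refl (toℕ j) | ∨-zeroʳ (suc (suc (toℕ j)) ≡ᵇ toℕ j) = refl

  leafPair⇒centre : ∀ (i : Fin n) (j′ : Fin (suc m)) jb →
                    fcAdjPair (i , Fin.suc (Fin.suc j′)) jb ≡ true → jb ≡ (i , 1F)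
  leafPair⇒centre i j′ (j , b) leaf~jb with toℕ i ≡ᵇ toℕ j in i≡ᵇj | toℕ b ≡ᵇ 1 in b≡ᵇ1
  leafPair⇒centre i j′ (j , b) () | false | _
  leafPair⇒centre i j′ (j , b) () | true | false
  ... | true | true = cong₂ _,_ (sym (toℕ-injective (fromT i≡ᵇj))) (toℕ-injective (fromT b≡ᵇ1))
    where
    fromT : ∀ {x y} → (x ≡ᵇ y) ≡ true → x ≡ y
    fromT {x} {y} x≡ᵇy = ≡ᵇ⇒≡ x y (Equivalence.from T-≡ x≡ᵇy)

  leaf~⇒centre : ∀ (i : Fin n) (j′ : Fin (suc m)) u →
                 adj G (combine i (Fin.suc (Fin.suc j′))) u ≡ true → u ≡ centre i
  leaf~⇒centre i j′ u leaf~u = begin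
    u                                 ≡⟨ combine-remQuot {n} K u ⟨
    uncurry combine (remQuot {n} K u) ≡⟨ cong (uncurry (combine {n})) (leafPair⇒centre i j′ _ leaf~remQuot-u) ⟩
    centre i                          ∎
    where
    open ≡-Reasoning
    leaf~remQuot-u : fcAdjPair (i , Fin.suc (Fin.suc j′)) (remQuot {n} K u) ≡ true
    leaf~remQuot-u = subst (λ ia → fcAdjPair ia (remQuot K u) ≡ true) (remQuot-combine i _) leaf~u

  labelling : Fin (n * K) ↔ Fin (n * K)
  labelling = blockwise {n} rotate↔

  label : Fin (n * K) → ℕ
  label u = suc (toℕ (Inverse.to labelling u))

  label-combine : ∀ (i : Fin n) (b : Fin K) → label (combine i b) ≡ suc (K * toℕ i + toℕ (rotate b))
  label-combine i b =
    cong suc (trans (cong toℕ (blockwise-combine {n} rotate↔ i b)) (toℕ-combine i (rotate b)))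

  label-centre : ∀ (i : Fin n) → label (centre i) ≡ suc (K * toℕ i)
  label-centre i = trans (label-combine i 1F) (cong suc (+-identityʳ (K * toℕ i)))

  label-path : ∀ (i : Fin n) → label (path i) ≡ K * suc (toℕ i)
  label-path i = begin
    label (path i)                        ≡⟨ label-combine i 0F ⟩
    suc (K * toℕ i + toℕ (fromℕ (2 + m))) ≡⟨ cong (λ r → suc (K * toℕ i + r)) (toℕ-fromℕ (2 + m)) ⟩
    suc (K * toℕ i + (2 + m))             ≡⟨ cong suc (+-comm (K * toℕ i) (2 + m)) ⟩
    K + K * toℕ i                         ≡⟨ *-suc K (toℕ i) ⟨
    K * suc (toℕ i)                       ∎
    where open ≡-Reasoning

  label-path≡suc-lastLeaf : ∀ (i : Fin n) → label (path i) ≡ suc (label (lastLeaf i))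
  label-path≡suc-lastLeaf i = begin
    label (path i)                                        ≡⟨ label-combine i 0F ⟩
    suc (K * toℕ i + toℕ (fromℕ (2 + m)))                 ≡⟨ cong (λ r → suc (K * toℕ i + r)) (toℕ-fromℕ (2 + m)) ⟩
    suc (K * toℕ i + suc (suc m))                         ≡⟨ cong suc (+-suc (K * toℕ i) (suc m)) ⟩
    suc (suc (K * toℕ i + suc m))                         ≡⟨ cong (λ r → suc (suc (K * toℕ i + r))) toℕ-rotate-last ⟨
    suc (suc (K * toℕ i + toℕ (inject₁ (fromℕ (1 + m))))) ≡⟨ cong suc (label-combine i (fromℕ (2 + m))) ⟨
    suc (label (lastLeaf i))                              ∎
    where
    open ≡-Reasoning
    toℕ-rotate-last : toℕ (inject₁ (fromℕ (1 + m))) ≡ suc m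
    toℕ-rotate-last = trans (toℕ-inject₁ (fromℕ (1 + m))) (toℕ-fromℕ (1 + m))

  NbhdGcd≡1 : Fin (n * K) → Set
  NbhdGcd≡1 v = gcdList (map label (nbhd G v)) ≡ 1

  centre-nbhdGcd≡1 : ∀ (i : Fin n) → NbhdGcd≡1 (centre i)
  centre-nbhdGcd≡1 i =
    nbhdGcd≡1-consecutive G label (centre~lastLeaf i) (centre~path i) (label-path≡suc-lastLeaf i)

  path-nbhdGcd≡1 : ∀ (i : Fin n) → NbhdGcd≡1 (path i)
  path-nbhdGcd≡1 i with toℕ≡0⊎pred i
  ... | inj₁ i≡0 = nbhdGcd≡1-one G label (path~centre i)
                     (trans (label-centre i) (cong suc (trans (cong (K *_) i≡0) (*-zeroʳ K))))
  ... | inj₂ (j , 1+j≡i) =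
    nbhdGcd≡1-consecutive G label (path~path i j 1+j≡i) (path~centre i)
      (trans (label-centre i) (cong suc (trans (cong (K *_) (sym 1+j≡i)) (sym (label-path j)))))

  isNeighborhoodPrimeLabeling : IsNeighborhoodPrimeLabeling G (Inverse.to labelling)
  isNeighborhoodPrimeLabeling u =
    subst (λ v → 1 < degree G v → NbhdGcd≡1 v) (combine-remQuot {n} K u) (uncurry byPosition (remQuot {n} K u))
    where
    byPosition : ∀ (i : Fin n) (a : Fin K) → 1 < degree G (combine i a) → NbhdGcd≡1 (combine i a)
    byPosition i 0F _ = path-nbhdGcd≡1 i
    byPosition i 1F _ = centre-nbhdGcd≡1 i
    byPosition i (Fin.suc (Fin.suc j′)) 1<deg
      with s≤s () ← ≤-trans 1<deg (degree≤1 G (centre i) (leaf~⇒centre i j′))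

mainTheorem14 : (n k : ℕ) → 1 ≤ n → 3 ≤ k → NeighborhoodPrime (firecracker n k)
mainTheorem14 n 0 _ ()
mainTheorem14 n 1 _ (s≤s ())
mainTheorem14 n 2 _ (s≤s (s≤s ()))
mainTheorem14 n (suc (suc (suc m))) _ _ = ↔⇒⤖ labelling , isNeighborhoodPrimeLabeling
  where open Firecracker n m
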